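{- Let $w\in S_n$ contain the pattern $132$, and let $p=\max\{t : \exists\, i<t<j,\ w_i<w_j<w_t\}$ and $q=\max\{j : j>p,\ w_j<w_p,\ \exists\, i<p,\ w_i<w_j\}$. Then $(p,w_q)$ is the largest element of $\mathrm{pivot}(w)$ with respect to the total order on boxes given by $(i,j)<(k,l)$ iff $i<k$, or $i=k$ and $j<l$.
   Context: Boxes $(r,c)$ of the $n\times n$ grid: row $r$ from top, column $c$ from left. The Rothe pipedream $D(w)$ has SE elbows exactly at the boxes $(k,w_k)$ and its empty boxes are $\{(r,c): w_r>c,\ w^{ -1}(c)>r\}$. For an empty box $(a,b)$ of $D(w)$, a pivot is an SE elbow $(k,w_k)$ with $k<a$, $w_k<b$ such that the rectangle with northwest corner $(k,w_k)$ and southeast corner $(a,b)$ contains no other SE elbow $(k',w_{k'})$. $\mathrm{pivot}(w)$ is the set of empty boxes of $D(w)$ having at least one pivot. -}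

module Defs where

open import Data.Nat using (ℕ)
open import Data.Fin using (Fin; _<_; _≤_)
open import Data.Fin.Permutation using (Permutation′; _⟨$⟩ʳ_; _⟨$⟩ˡ_)
open import Data.Product using (_×_; _,_; ∃; ∃-syntax)
open import Data.Sum using (_⊎_)
open import Relation.Binary.PropositionalEquality using (_≡_; _≢_)
open import Relation.Nullary using (¬_)

-- Positions and values are 0-based: w : Permutation′ n acts on Fin n,
-- w_k is  w ⟨$⟩ʳ k  and  w⁻¹(c) is  w ⟨$⟩ˡ c.

Box : ℕ → Set
Box n = Fin n × Fin n

Contains132 : ∀ {n} → Permutation′ n → Set
Contains132 {n} w = ∃[ i ] ∃[ t ] ∃[ j ]
  (i < t × t < j × (w ⟨$⟩ʳ i) < (w ⟨$⟩ʳ j) × (w ⟨$⟩ʳ j) < (w ⟨$⟩ʳ t))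

-- empty boxes of the Rothe pipedream D(w): w_r > c and w⁻¹(c) > r
EmptyBox : ∀ {n} → Permutation′ n → Box n → Set
EmptyBox w (r , c) = c < (w ⟨$⟩ʳ r) × r < (w ⟨$⟩ˡ c)

InRect : ∀ {n} → Permutation′ n → Fin n → Box n → Fin n → Set
InRect w k (a , b) k' =
  k ≤ k' × k' ≤ a × (w ⟨$⟩ʳ k) ≤ (w ⟨$⟩ʳ k') × (w ⟨$⟩ʳ k') ≤ b

IsPivot : ∀ {n} → Permutation′ n → Fin n → Box n → Set
IsPivot {n} w k (a , b) =
  k < a × (w ⟨$⟩ʳ k) < b ×
  (∀ (k' : Fin n) → InRect w k (a , b) k' → k' ≡ k)

InPivotSet : ∀ {n} → Permutation′ n → Box n → Set
InPivotSet w x = EmptyBox w x × ∃[ k ] IsPivot w k x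

_<ᴮ_ : ∀ {n} → Box n → Box n → Set
(i , j) <ᴮ (k , l) = i < k ⊎ (i ≡ k × j < l)

_≤ᴮ_ : ∀ {n} → Box n → Box n → Set
x ≤ᴮ y = x <ᴮ y ⊎ x ≡ y

PSet : ∀ {n} → Permutation′ n → Fin n → Set
PSet w t = ∃[ i ] ∃[ j ]
  (i < t × t < j × (w ⟨$⟩ʳ i) < (w ⟨$⟩ʳ j) × (w ⟨$⟩ʳ j) < (w ⟨$⟩ʳ t))

QSet : ∀ {n} → Permutation′ n → Fin n → Fin n → Set
QSet w p j = p < j × (w ⟨$⟩ʳ j) < (w ⟨$⟩ʳ p) × (∃[ i ] (i < p × (w ⟨$⟩ʳ i) < (w ⟨$⟩ʳ j)))

IsMax : ∀ {n} → (Fin n → Set) → Fin n → Set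
IsMax {n} P m = P m × (∀ (x : Fin n) → P x → x ≤ m)

IsLargestPivot : ∀ {n} → Permutation′ n → Box n → Set
IsLargestPivot {n} w x = InPivotSet w x × (∀ (y : Box n) → InPivotSet w y → y ≤ᴮ x)

-- A pivot (k, w_k) of an empty box (a, b) together with j = w⁻¹(b) forms a 132-pattern
-- k < a < j with w_k < w_j < w_a. Hence a ≤ p, and if a = p then j lies in the set defining q,
-- so b = w_j ≤ w_q by maximality of p. Conversely (p, w_q) is empty, and the last row k < p
-- with w_k < w_q is a pivot of it: nothing else fits in the rectangle.
module Submission where

open import Defs
open import Data.Nat using (ℕ; z≤n; s≤s)
import Data.Nat.Properties as ℕₚ
open import Data.Fin using (Fin; zero; suc; _<_; _≤_)
open import Data.Fin.Properties using (any?; _<?_; ≤-antisym; ≤∧≢⇒<; <-irrefl; <-trans; toℕ-injective)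
open import Data.Fin.Permutation using (Permutation′; _⟨$⟩ʳ_; _⟨$⟩ˡ_; inverseˡ; inverseʳ)
open import Data.Product using (∃; _×_; _,_; proj₂)
open import Data.Sum using (inj₁; inj₂)
open import Data.Empty using (⊥-elim)
open import Function using (_∘_)
open import Relation.Nullary using (yes; no)
open import Relation.Nullary.Decidable using (_×-dec_)
open import Relation.Unary using (Decidable)
open import Relation.Binary.PropositionalEquality using (_≡_; refl; sym; trans; cong; subst)

maximum : ∀ {n} {P : Fin n → Set} → Decidable P → ∃ P → ∃ (IsMax P)
maximum {Data.Nat.suc n} {P} P? (x , Px) with any? (P? ∘ suc)
... | yes witness with maximum (P? ∘ suc) witness
...   | m , Pm , m-max = suc m , Pm , λ { zero _ → z≤n ; (suc y) Py → s≤s (m-max y Py) }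
maximum {Data.Nat.suc n} {P} P? (x , Px) | no none = zero , P-zero x Px , λ
  { zero _ → z≤n ; (suc y) Py → ⊥-elim (none (y , Py)) }
  where
  P-zero : ∀ x → P x → P zero
  P-zero zero    Px = Px
  P-zero (suc x) Px = ⊥-elim (none (x , Px))

≤ᴮ-intro : ∀ {n} {a b c d : Fin n} → a ≤ c → (a ≡ c → b ≤ d) → (a , b) ≤ᴮ (c , d)
≤ᴮ-intro a≤c b≤d with ℕₚ.m≤n⇒m<n∨m≡n a≤c
... | inj₁ a<c = inj₁ (inj₁ a<c)
... | inj₂ a≡c with toℕ-injective a≡c
...   | refl with ℕₚ.m≤n⇒m<n∨m≡n (b≤d refl)
...     | inj₁ b<d = inj₁ (inj₂ (refl , b<d))
...     | inj₂ b≡d = inj₂ (cong (_ ,_) (toℕ-injective b≡d))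

module _ {n} (w : Permutation′ n) where

  inversion⇒EmptyBox : ∀ {p q} → p < q → w ⟨$⟩ʳ q < w ⟨$⟩ʳ p → EmptyBox w (p , w ⟨$⟩ʳ q)
  inversion⇒EmptyBox p<q wq<wp = wq<wp , subst (_ <_) (sym (inverseˡ w)) p<q

  SmallerBefore : Box n → Fin n → Set
  SmallerBefore (a , b) i = i < a × w ⟨$⟩ʳ i < b

  lastSmallerBefore-isPivot : ∀ {a b k} → EmptyBox w (a , b) →
    IsMax (SmallerBefore (a , b)) k → IsPivot w k (a , b)
  lastSmallerBefore-isPivot {a} {b} {k} (b<wa , a<w⁻¹b) ((k<a , wk<b) , k-max) =
    k<a , wk<b , onlyElbow
    where
    onlyElbow : ∀ k' → InRect w k (a , b) k' → k' ≡ k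
    onlyElbow k' (k≤k' , k'≤a , _ , wk'≤b) = ≤-antisym (k-max k' (k'<a , wk'<b)) k≤k'
      where
      k'<a : k' < a
      k'<a = ≤∧≢⇒< k'≤a λ { refl → ℕₚ.<⇒≱ b<wa wk'≤b }
      wk'<b : w ⟨$⟩ʳ k' < b
      wk'<b = ≤∧≢⇒< wk'≤b λ wk'≡b →
        ℕₚ.<⇒≱ a<w⁻¹b (subst (_≤ a) (trans (sym (inverseˡ w)) (cong (w ⟨$⟩ˡ_) wk'≡b)) k'≤a)

  EmptyBox⇒InPivotSet : ∀ {x} → EmptyBox w x → ∃ (SmallerBefore x) → InPivotSet w x
  EmptyBox⇒InPivotSet {a , b} empty smaller with maximum (λ i → (i <? a) ×-dec (w ⟨$⟩ʳ i <? b)) smaller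
  ... | k , k-max = empty , k , lastSmallerBefore-isPivot empty k-max

  QSet⇒PSet : ∀ {t j} → QSet w t j → PSet w t
  QSet⇒PSet {j = j} (t<j , wj<wt , i , i<t , wi<wj) = i , j , i<t , t<j , wi<wj , wj<wt

  InPivotSet⇒QSet : ∀ {a b} → InPivotSet w (a , b) → QSet w a (w ⟨$⟩ˡ b)
  InPivotSet⇒QSet ((b<wa , a<w⁻¹b) , k , k<a , wk<b , _) =
    a<w⁻¹b , subst (_< _) (sym (inverseʳ w)) b<wa , k , k<a , subst (_ <_) (sym (inverseʳ w)) wk<b

  module _ {p} (p-max : IsMax (PSet w) p) where

    pivotRow-≤ : ∀ {a b} → InPivotSet w (a , b) → a ≤ p
    pivotRow-≤ {a} piv = proj₂ p-max a (QSet⇒PSet (InPivotSet⇒QSet piv))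

    -- A later j in QSet with a larger value would put p inside the 132-pattern (i, j, q) with j > p.
    QSet-maximum-lowest : ∀ {q j} → IsMax (QSet w p) q → QSet w p j → w ⟨$⟩ʳ j ≤ w ⟨$⟩ʳ q
    QSet-maximum-lowest {q} {j} ((_ , _ , i , i<p , wi<wq) , q-max) Qj@(p<j , _) =
      ℕₚ.≮⇒≥ λ wq<wj →
        let j<q = ≤∧≢⇒< (q-max j Qj) λ { refl → <-irrefl refl wq<wj }
        in ℕₚ.<⇒≱ p<j (proj₂ p-max j (i , q , <-trans i<p p<j , j<q , wi<wq , wq<wj))

    pivotColumn-≤ : ∀ {q b} → IsMax (QSet w p) q → InPivotSet w (p , b) → b ≤ w ⟨$⟩ʳ q
    pivotColumn-≤ q-max piv =
      subst (_≤ _) (inverseʳ w) (QSet-maximum-lowest q-max (InPivotSet⇒QSet piv))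

proposition4p7 : (n : ℕ) (w : Permutation′ n) → Contains132 w →
    (p q : Fin n) → IsMax (PSet w) p → IsMax (QSet w p) q →
    IsLargestPivot w (p , (w ⟨$⟩ʳ q))
proposition4p7 n w _ p q p-max q-max@((p<q , wq<wp , i , i<p , wi<wq) , _) =
  EmptyBox⇒InPivotSet w (inversion⇒EmptyBox w p<q wq<wp) (i , i<p , wi<wq) ,
  λ { (a , b) piv → ≤ᴮ-intro (pivotRow-≤ w p-max piv)
                             (λ { refl → pivotColumn-≤ w p-max q-max piv }) }
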